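{- Let $G$ and $H$ be connected graphs. If $\mu_{\rm t}(G\,\square\,H)=1$, then $\mu_{\rm t}(G)=1$ and $\mu_{\rm t}(H)=1$.
   Context: All graphs are finite, simple and connected. The Cartesian product $G\,\square\,H$ has vertex set $V(G)\times V(H)$, with $(g,h)$ adjacent to $(g',h')$ iff either $gg'\in E(G)$ and $h=h'$, or $g=g'$ and $hh'\in E(H)$. For $X\subseteq V(G)$, two vertices $x,y$ are $X$-visible if there is a shortest $x,y$-path $P$ with $V(P)\cap X\subseteq\{x,y\}$; $X$ is a total mutual-visibility set if every pair of vertices of $G$ is $X$-visible. $\mu_{\rm t}(G)$ is the largest cardinality of a total mutual-visibility set of $G$. -}

module Defs where

open import Data.Nat using (ℕ; zero; suc; _+_; _*_; _≤_)
open import Data.Fin using (Fin; remQuot)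
open import Data.Fin.Subset using (Subset; _∈_; ∣_∣)
open import Data.Product using (_×_; _,_; proj₁; proj₂; Σ; ∃)
open import Data.Sum using (_⊎_; inj₁; inj₂)
open import Relation.Nullary using (¬_)
open import Relation.Binary.PropositionalEquality using (_≡_; refl; sym)

record Graph : Set₁ where
  field
    n      : ℕ
    Adj    : Fin n → Fin n → Set
    irrefl : ∀ {x} → ¬ Adj x x
    symm   : ∀ {x y} → Adj x y → Adj y x
open Graph public

data Walk (G : Graph) : Fin (n G) → Fin (n G) → Set where
  []  : ∀ {x} → Walk G x x
  _∷_ : ∀ {x y z} → Adj G x y → Walk G y z → Walk G x z

len : ∀ {G x y} → Walk G x y → ℕ
len []      = 0
len (_ ∷ p) = suc (len p)

data OnWalk {G : Graph} (v : Fin (n G)) : ∀ {x y} → Walk G x y → Set where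
  here  : ∀ {x} {p : Walk G v x} → OnWalk v p
  there : ∀ {x y z} {e : Adj G x y} {p : Walk G y z} → OnWalk v p → OnWalk v (e ∷ p)

Connected : Graph → Set
Connected G = ∀ x y → Walk G x y

IsShortest : ∀ {G x y} → Walk G x y → Set
IsShortest {G} {x} {y} p = ∀ (q : Walk G x y) → len p ≤ len q

Visible : (G : Graph) → Subset (n G) → Fin (n G) → Fin (n G) → Set
Visible G X x y =
  Σ (Walk G x y) λ p → IsShortest p ×
    (∀ v → OnWalk v p → v ∈ X → v ≡ x ⊎ v ≡ y)

IsTotalMutualVisibilitySet : (G : Graph) → Subset (n G) → Set
IsTotalMutualVisibilitySet G X = ∀ x y → Visible G X x y

TotalMutualVisibilityNumber : Graph → ℕ → Set
TotalMutualVisibilityNumber G k =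
  (Σ (Subset (n G)) λ X → IsTotalMutualVisibilitySet G X × ∣ X ∣ ≡ k) ×
  (∀ X → IsTotalMutualVisibilitySet G X → ∣ X ∣ ≤ k)

-- Cartesian product G □ H on Fin (n G * n H), vertex i ↔ remQuot i = (g , h).
□Adj : (G H : Graph) → Fin (n G * n H) → Fin (n G * n H) → Set
□Adj G H i j with remQuot {n G} (n H) i | remQuot {n G} (n H) j
... | g , h | g' , h' = (Adj G g g' × h ≡ h') ⊎ (g ≡ g' × Adj H h h')

□irrefl : (G H : Graph) → ∀ {i} → ¬ □Adj G H i i
□irrefl G H {i} with remQuot {n G} (n H) i
... | g , h = λ { (inj₁ (a , _)) → irrefl G a ; (inj₂ (_ , a)) → irrefl H a }

□symm : (G H : Graph) → ∀ {i j} → □Adj G H i j → □Adj G H j i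
□symm G H {i} {j} with remQuot {n G} (n H) i | remQuot {n G} (n H) j
... | g , h | g' , h' = λ { (inj₁ (a , e)) → inj₁ (symm G a , sym e)
                          ; (inj₂ (e , a)) → inj₂ (sym e , symm H a) }

_□_ : Graph → Graph → Graph
G □ H = record { n = n G * n H ; Adj = □Adj G H
               ; irrefl = λ {i} → □irrefl G H {i}
               ; symm = λ {i} {j} → □symm G H {i} {j} }

-- A shortest walk of G □ H projects onto shortest walks of G and H whose lengths add
-- up to its own length; conversely a shortest walk of G followed by one of H, each
-- lifted to a layer, is shortest in G □ H. Projecting into G the walks of G □ H that
-- stay in the H-layer of the single vertex u of an optimal set shows that {u_G} is a
-- total mutual-visibility set of G. If G had such a set containing two vertices a ≠ b,
-- then {(a,h),(b,h)} would be one of G □ H, where {h} is a total mutual-visibility set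
-- of H obtained in the same way; so μ_t(G) = 1, and likewise μ_t(H) = 1.
module Submission where

open import Defs
open import Data.Empty using (⊥-elim)
open import Data.Fin using (Fin; _≟_; combine; remQuot)
open import Data.Fin.Properties using (remQuot-combine; combine-remQuot)
open import Data.Fin.Subset using (Subset; _∈_; _⊆_; _⊂_; ∣_∣; ⁅_⁆; _∪_; Nonempty; Empty)
open import Data.Fin.Subset.Properties
  using (nonempty?; Empty-unique; ∣⊥∣≡0; ∣⁅x⁆∣≡1; x∈⁅x⁆; x∈⁅y⁆⇒x≡y; x≢y⇒x∉⁅y⁆;
         p⊆q⇒∣p∣≤∣q∣; p⊂q⇒∣p∣<∣q∣; p⊆p∪q; q⊆p∪q; x∈p∪q⁻)
open import Data.Nat using (suc; _+_; _≤_; z≤n)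
open import Data.Nat.Properties
  using (≤-trans; ≤-reflexive; <⇒≱; +-mono-≤; +-suc; +-comm; +-identityʳ; m≤m+n;
         +-cancelˡ-≤; n≤0⇒n≡0; 1+n≢0; module ≤-Reasoning)
open import Data.Product using (_×_; _,_; proj₁; proj₂; ∃)
open import Data.Sum using (_⊎_; inj₁; inj₂)
import Data.Sum as Sum
open import Relation.Nullary using (¬_; yes; no)
open import Relation.Nullary.Decidable using (decidable-stable)
open import Function using (_∘_)
open import Relation.Binary.PropositionalEquality

Empty⇒∣p∣≡0 : ∀ {k} {p : Subset k} → Empty p → ∣ p ∣ ≡ 0
Empty⇒∣p∣≡0 {k} e = trans (cong ∣_∣ (Empty-unique e)) (∣⊥∣≡0 k)

∣p∣≢0⇒Nonempty : ∀ {k} (p : Subset k) → ¬ ∣ p ∣ ≡ 0 → Nonempty p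
∣p∣≢0⇒Nonempty p ∣p∣≢0 = decidable-stable (nonempty? p) (λ e → ∣p∣≢0 (Empty⇒∣p∣≡0 e))

subsingleton⇒∣p∣≤1 : ∀ {k} (p : Subset k) → (∀ {a b} → a ∈ p → b ∈ p → a ≡ b) → ∣ p ∣ ≤ 1
subsingleton⇒∣p∣≤1 p all-equal with nonempty? p
... | no e = ≤-trans (≤-reflexive (Empty⇒∣p∣≡0 e)) z≤n
... | yes (a , a∈p) = ≤-trans (p⊆q⇒∣p∣≤∣q∣ p⊆⁅a⁆) (≤-reflexive (∣⁅x⁆∣≡1 a))
  where
  p⊆⁅a⁆ : p ⊆ ⁅ a ⁆
  p⊆⁅a⁆ b∈p = subst (_∈ ⁅ a ⁆) (all-equal a∈p b∈p) (x∈⁅x⁆ a)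

x≢y⇒2≤∣⁅x⁆∪⁅y⁆∣ : ∀ {k} {x y : Fin k} → ¬ x ≡ y → 2 ≤ ∣ ⁅ x ⁆ ∪ ⁅ y ⁆ ∣
x≢y⇒2≤∣⁅x⁆∪⁅y⁆∣ {x = x} {y} x≢y = subst (_≤ ∣ ⁅ x ⁆ ∪ ⁅ y ⁆ ∣) (cong suc (∣⁅x⁆∣≡1 x)) (p⊂q⇒∣p∣<∣q∣ ⁅x⁆⊂)
  where
  ⁅x⁆⊂ : ⁅ x ⁆ ⊂ ⁅ x ⁆ ∪ ⁅ y ⁆
  ⁅x⁆⊂ = p⊆p∪q ⁅ y ⁆ , y , q⊆p∪q ⁅ x ⁆ ⁅ y ⁆ (x∈⁅x⁆ y) , x≢y⇒x∉⁅y⁆ (λ y≡x → x≢y (sym y≡x))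

cast : ∀ {G x y x′ y′} → x ≡ x′ → y ≡ y′ → Walk G x y → Walk G x′ y′
cast refl refl p = p

len-cast : ∀ {G x y x′ y′} (e : x ≡ x′) (e′ : y ≡ y′) (p : Walk G x y) → len (cast e e′ p) ≡ len p
len-cast refl refl p = refl

onWalk-cast⁻ : ∀ {G x y x′ y′ v} (e : x ≡ x′) (e′ : y ≡ y′) (p : Walk G x y) →
  OnWalk v (cast e e′ p) → OnWalk v p
onWalk-cast⁻ refl refl p v∈p = v∈p

_++_ : ∀ {G x y z} → Walk G x y → Walk G y z → Walk G x z
[] ++ q = q
(e ∷ p) ++ q = e ∷ (p ++ q)

len-++ : ∀ {G x y z} (p : Walk G x y) (q : Walk G y z) → len (p ++ q) ≡ len p + len q
len-++ [] q = refl
len-++ (e ∷ p) q = cong suc (len-++ p q)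

onWalk-++⁻ : ∀ {G x y z v} (p : Walk G x y) (q : Walk G y z) →
  OnWalk v (p ++ q) → OnWalk v p ⊎ OnWalk v q
onWalk-++⁻ [] q v∈q = inj₂ v∈q
onWalk-++⁻ (e ∷ p) q here = inj₁ here
onWalk-++⁻ (e ∷ p) q (there v∈pq) = Sum.map₁ there (onWalk-++⁻ p q v∈pq)

tmvs-⊆ : ∀ {G X Y} → Y ⊆ X → IsTotalMutualVisibilitySet G X → IsTotalMutualVisibilitySet G Y
tmvs-⊆ Y⊆X X-tmvs x y with X-tmvs x y
... | p , p-shortest , p-avoids = p , p-shortest , λ v v∈p v∈Y → p-avoids v v∈p (Y⊆X v∈Y)

data ProductAdj (G H : Graph) (g : Fin (n G)) (h : Fin (n H)) (g′ : Fin (n G)) (h′ : Fin (n H))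
  : Set where
  moveˡ : Adj G g g′ → h ≡ h′ → ProductAdj G H g h g′ h′
  moveʳ : g ≡ g′ → Adj H h h′ → ProductAdj G H g h g′ h′

ProductAdj-swap : ∀ {G H g h g′ h′} → ProductAdj G H g h g′ h′ → ProductAdj H G h g h′ g′
ProductAdj-swap (moveˡ a h≡h′) = moveʳ h≡h′ a
ProductAdj-swap (moveʳ g≡g′ a) = moveˡ a g≡g′

record CartesianProduct (G H P : Graph) : Set where
  field
    fst      : Fin (n P) → Fin (n G)
    snd      : Fin (n P) → Fin (n H)
    pair     : Fin (n G) → Fin (n H) → Fin (n P)
    fst-pair : ∀ g h → fst (pair g h) ≡ g
    snd-pair : ∀ g h → snd (pair g h) ≡ h
    pair-η   : ∀ u → pair (fst u) (snd u) ≡ u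
    adj⁻     : ∀ {u v} → Adj P u v → ProductAdj G H (fst u) (snd u) (fst v) (snd v)
    adjˡ     : ∀ {g g′} h → Adj G g g′ → Adj P (pair g h) (pair g′ h)
    adjʳ     : ∀ g {h h′} → Adj H h h′ → Adj P (pair g h) (pair g h′)

  pair-injective : ∀ {g h g′ h′} → pair g h ≡ pair g′ h′ → g ≡ g′ × h ≡ h′
  pair-injective {g} {h} {g′} {h′} e =
    trans (sym (fst-pair g h)) (trans (cong fst e) (fst-pair g′ h′)) ,
    trans (sym (snd-pair g h)) (trans (cong snd e) (snd-pair g′ h′))

swap : ∀ {G H P} → CartesianProduct G H P → CartesianProduct H G P
swap S = record
  { fst = snd ; snd = fst ; pair = λ h g → pair g h
  ; fst-pair = λ h g → snd-pair g h ; snd-pair = λ h g → fst-pair g h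
  ; pair-η = pair-η ; adj⁻ = λ e → ProductAdj-swap (adj⁻ e)
  ; adjˡ = λ g → adjʳ g ; adjʳ = λ h → adjˡ h }
  where open CartesianProduct S

□-cartesianProduct : (G H : Graph) → CartesianProduct G H (G □ H)
□-cartesianProduct G H = record
  { fst = λ i → proj₁ (remQuot {n G} (n H) i)
  ; snd = λ i → proj₂ (remQuot {n G} (n H) i)
  ; pair = combine
  ; fst-pair = fst-combine ; snd-pair = snd-combine
  ; pair-η = combine-remQuot {n G} (n H)
  ; adj⁻ = λ { (inj₁ (a , h≡h′)) → moveˡ a h≡h′ ; (inj₂ (g≡g′ , a)) → moveʳ g≡g′ a }
  ; adjˡ = λ {g} {g′} h a →
      inj₁ (subst₂ (Adj G) (sym (fst-combine g h)) (sym (fst-combine g′ h)) a ,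
            trans (snd-combine g h) (sym (snd-combine g′ h)))
  ; adjʳ = λ g {h} {h′} a →
      inj₂ (trans (fst-combine g h) (sym (fst-combine g h′)) ,
            subst₂ (Adj H) (sym (snd-combine g h)) (sym (snd-combine g h′)) a) }
  where
  fst-combine : ∀ g h → proj₁ (remQuot {n G} (n H) (combine g h)) ≡ g
  fst-combine g h = cong proj₁ (remQuot-combine g h)
  snd-combine : ∀ g h → proj₂ (remQuot {n G} (n H) (combine g h)) ≡ h
  snd-combine g h = cong proj₂ (remQuot-combine g h)

stepˡ : ∀ {G H g h g′ h′ z} → ProductAdj G H g h g′ h′ → Walk G g′ z → Walk G g z
stepˡ (moveˡ a _) p = a ∷ p
stepˡ (moveʳ g≡g′ _) p = cast (sym g≡g′) refl p

len-stepˡ+stepʳ : ∀ {G H g h g′ h′ z z′} (s : ProductAdj G H g h g′ h′)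
  (p : Walk G g′ z) (q : Walk H h′ z′) →
  len (stepˡ s p) + len (stepˡ (ProductAdj-swap s) q) ≡ suc (len p + len q)
len-stepˡ+stepʳ (moveˡ _ h≡h′) p q = cong (λ l → suc (len p + l)) (len-cast (sym h≡h′) refl q)
len-stepˡ+stepʳ (moveʳ g≡g′ _) p q =
  trans (cong (_+ suc (len q)) (len-cast (sym g≡g′) refl p)) (+-suc (len p) (len q))

module _ {G H P : Graph} (S : CartesianProduct G H P) where
  open CartesianProduct S

  projectˡ : ∀ {u v} → Walk P u v → Walk G (fst u) (fst v)
  projectˡ [] = []
  projectˡ (e ∷ w) = stepˡ (adj⁻ e) (projectˡ w)

  layerˡ : ∀ {g g′} h → Walk G g g′ → Walk P (pair g h) (pair g′ h)
  layerˡ h [] = []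
  layerˡ h (a ∷ p) = adjˡ h a ∷ layerˡ h p

  len-layerˡ : ∀ {g g′} h (p : Walk G g g′) → len (layerˡ h p) ≡ len p
  len-layerˡ h [] = refl
  len-layerˡ h (a ∷ p) = cong suc (len-layerˡ h p)

  onWalk-layerˡ⁻ : ∀ {g g′ v} h (p : Walk G g g′) →
    OnWalk v (layerˡ h p) → ∃ λ x → OnWalk x p × v ≡ pair x h
  onWalk-layerˡ⁻ h [] here = _ , here , refl
  onWalk-layerˡ⁻ h (a ∷ p) here = _ , here , refl
  onWalk-layerˡ⁻ h (a ∷ p) (there v∈p) with onWalk-layerˡ⁻ h p v∈p
  ... | x , x∈p , v≡xh = x , there x∈p , v≡xh

module _ {G H P : Graph} (S : CartesianProduct G H P) where
  open CartesianProduct S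

  projectʳ : ∀ {u v} → Walk P u v → Walk H (snd u) (snd v)
  projectʳ = projectˡ (swap S)

  layerʳ : ∀ {h h′} g → Walk H h h′ → Walk P (pair g h) (pair g h′)
  layerʳ = layerˡ (swap S)

  len-project : ∀ {u v} (w : Walk P u v) → len (projectˡ S w) + len (projectʳ w) ≡ len w
  len-project [] = refl
  len-project (e ∷ w) =
    trans (len-stepˡ+stepʳ (adj⁻ e) (projectˡ S w) (projectʳ w)) (cong suc (len-project w))

  -- Every edge of w that moves in H is an edge of projectʳ w, so if projectʳ w is
  -- trivial then w never leaves its initial H-layer.
  onWalk-projectˡ⁻ : ∀ {u v g} (w : Walk P u v) → len (projectʳ w) ≡ 0 →
    OnWalk g (projectˡ S w) → ∃ λ u′ → OnWalk u′ w × u′ ≡ pair g (snd u)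
  onWalk-projectˡ⁻ {u} [] _ here = u , here , sym (pair-η u)
  onWalk-projectˡ⁻ (e ∷ w) = onWalk-stepˡ⁻ e w (adj⁻ e) (onWalk-projectˡ⁻ w)
    where
    onWalk-stepˡ⁻ : ∀ {u v z g} (e : Adj P u v) (w : Walk P v z)
      (s : ProductAdj G H (fst u) (snd u) (fst v) (snd v)) →
      (len (projectʳ w) ≡ 0 → OnWalk g (projectˡ S w) → ∃ λ u′ → OnWalk u′ w × u′ ≡ pair g (snd v)) →
      len (stepˡ (ProductAdj-swap s) (projectʳ w)) ≡ 0 → OnWalk g (stepˡ s (projectˡ S w)) →
      ∃ λ u′ → OnWalk u′ (e ∷ w) × u′ ≡ pair g (snd u)
    onWalk-stepˡ⁻ {u} e w (moveˡ _ _) ih trivial here = u , here , sym (pair-η u)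
    onWalk-stepˡ⁻ e w (moveˡ _ h≡h′) ih trivial (there g∈w)
      with ih (trans (sym (len-cast (sym h≡h′) refl (projectʳ w))) trivial) g∈w
    ... | u′ , u′∈w , u′≡gh = u′ , there u′∈w , trans u′≡gh (cong (pair _) (sym h≡h′))
    onWalk-stepˡ⁻ e w (moveʳ _ _) ih () g∈w

  shadowˡ : ∀ {x y h h′} → Walk P (pair x h) (pair y h′) → Walk G x y
  shadowˡ {x} {y} {h} {h′} w = cast (fst-pair x h) (fst-pair y h′) (projectˡ S w)

  shadowʳ : ∀ {x y h h′} → Walk P (pair x h) (pair y h′) → Walk H h h′
  shadowʳ {x} {y} {h} {h′} w = cast (snd-pair x h) (snd-pair y h′) (projectʳ w)

  len-shadow : ∀ {x y h h′} (w : Walk P (pair x h) (pair y h′)) →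
    len (shadowˡ w) + len (shadowʳ w) ≡ len w
  len-shadow {x} {y} {h} {h′} w = begin
    len (shadowˡ w) + len (shadowʳ w)
      ≡⟨ cong₂ _+_ (len-cast (fst-pair x h) (fst-pair y h′) (projectˡ S w))
                   (len-cast (snd-pair x h) (snd-pair y h′) (projectʳ w)) ⟩
    len (projectˡ S w) + len (projectʳ w)
      ≡⟨ len-project w ⟩
    len w ∎
    where open ≡-Reasoning

  shortest-sum-≤ : ∀ {x y h h′} {p : Walk G x y} {q : Walk H h h′} →
    IsShortest p → IsShortest q → (r : Walk P (pair x h) (pair y h′)) → len p + len q ≤ len r
  shortest-sum-≤ p-shortest q-shortest r =
    ≤-trans (+-mono-≤ (p-shortest (shadowˡ r)) (q-shortest (shadowʳ r))) (≤-reflexive (len-shadow r))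

  layerˡ++layerʳ-shortest : ∀ {x y h h′} {p : Walk G x y} {q : Walk H h h′} →
    IsShortest p → IsShortest q → IsShortest (layerˡ S h p ++ layerʳ y q)
  layerˡ++layerʳ-shortest {h = h} {p = p} {q} p-shortest q-shortest r = begin
    len (layerˡ S h p ++ layerʳ _ q)        ≡⟨ len-++ (layerˡ S h p) (layerʳ _ q) ⟩
    len (layerˡ S h p) + len (layerʳ _ q)   ≡⟨ cong₂ _+_ (len-layerˡ S h p) (len-layerˡ (swap S) _ q) ⟩
    len p + len q                           ≤⟨ shortest-sum-≤ p-shortest q-shortest r ⟩
    len r                                   ∎
    where open ≤-Reasoning

  layerʳ++layerˡ-shortest : ∀ {x y h h′} {p : Walk G x y} {q : Walk H h h′} →
    IsShortest p → IsShortest q → IsShortest (layerʳ x q ++ layerˡ S h′ p)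
  layerʳ++layerˡ-shortest {x} {h′ = h′} {p} {q} p-shortest q-shortest r = begin
    len (layerʳ x q ++ layerˡ S h′ p)        ≡⟨ len-++ (layerʳ x q) (layerˡ S h′ p) ⟩
    len (layerʳ x q) + len (layerˡ S h′ p)   ≡⟨ cong₂ _+_ (len-layerˡ (swap S) x q) (len-layerˡ S h′ p) ⟩
    len q + len p                            ≡⟨ +-comm (len q) (len p) ⟩
    len p + len q                            ≤⟨ shortest-sum-≤ p-shortest q-shortest r ⟩
    len r                                    ∎
    where open ≤-Reasoning

  module _ {x y h} (w : Walk P (pair x h) (pair y h)) (w-shortest : IsShortest w) where

    private
      len-w≤len-shadowˡ : len w ≤ len (shadowˡ w)
      len-w≤len-shadowˡ = ≤-trans (w-shortest (layerˡ S h (shadowˡ w))) (≤-reflexive (len-layerˡ S h (shadowˡ w)))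

    len-shadowʳ≡0 : len (shadowʳ w) ≡ 0
    len-shadowʳ≡0 = n≤0⇒n≡0 (+-cancelˡ-≤ (len (shadowˡ w)) _ 0 (begin
      len (shadowˡ w) + len (shadowʳ w)   ≡⟨ len-shadow w ⟩
      len w                               ≤⟨ len-w≤len-shadowˡ ⟩
      len (shadowˡ w)                     ≡⟨ +-identityʳ _ ⟨
      len (shadowˡ w) + 0                 ∎))
      where open ≤-Reasoning

    shadowˡ-shortest : IsShortest (shadowˡ w)
    shadowˡ-shortest q = begin
      len (shadowˡ w)                     ≤⟨ m≤m+n _ _ ⟩
      len (shadowˡ w) + len (shadowʳ w)   ≡⟨ len-shadow w ⟩
      len w                               ≤⟨ w-shortest (layerˡ S h q) ⟩
      len (layerˡ S h q)                  ≡⟨ len-layerˡ S h q ⟩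
      len q                               ∎
      where open ≤-Reasoning

    onWalk-shadowˡ⁻ : ∀ {g} → OnWalk g (shadowˡ w) → ∃ λ u → OnWalk u w × u ≡ pair g h
    onWalk-shadowˡ⁻ g∈w
      with onWalk-projectˡ⁻ w (trans (sym (len-cast (snd-pair x h) (snd-pair y h) (projectʳ w))) len-shadowʳ≡0)
                              (onWalk-cast⁻ (fst-pair x h) (fst-pair y h) (projectˡ S w) g∈w)
    ... | u , u∈w , u≡gh = u , u∈w , trans u≡gh (cong (pair _) (snd-pair x h))

module _ {G H P : Graph} (S : CartesianProduct G H P) where
  open CartesianProduct S

  tmvs-⁅fst⁆ : ∀ u → IsTotalMutualVisibilitySet P ⁅ u ⁆ → IsTotalMutualVisibilitySet G ⁅ fst u ⁆
  tmvs-⁅fst⁆ u ⁅u⁆-tmvs x y with ⁅u⁆-tmvs (pair x (snd u)) (pair y (snd u))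
  ... | w , w-shortest , w-avoids = shadowˡ S w , shadowˡ-shortest S w w-shortest , shadow-avoids
    where
    shadow-avoids : ∀ g → OnWalk g (shadowˡ S w) → g ∈ ⁅ fst u ⁆ → g ≡ x ⊎ g ≡ y
    shadow-avoids g g∈w g∈⁅u⁆ with onWalk-shadowˡ⁻ S w w-shortest g∈w
    ... | _ , gh∈w , refl =
      Sum.map (proj₁ ∘ pair-injective) (proj₁ ∘ pair-injective) (w-avoids _ gh∈w gh∈⁅u⁆)
      where
      gh∈⁅u⁆ : pair g (snd u) ∈ ⁅ u ⁆
      gh∈⁅u⁆ = subst (_∈ ⁅ u ⁆) (sym (trans (cong (λ g → pair g (snd u)) (x∈⁅y⁆⇒x≡y _ g∈⁅u⁆)) (pair-η u))) (x∈⁅x⁆ u)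

  -- The walk first moves in H and then in G when it ends outside the layer of h;
  -- otherwise it first moves in G and then in H.
  tmvs-layerˡ : ∀ {X T h} → IsTotalMutualVisibilitySet G X → IsTotalMutualVisibilitySet H ⁅ h ⁆ →
    (∀ {g h′} → pair g h′ ∈ T → g ∈ X × h′ ≡ h) → IsTotalMutualVisibilitySet P T
  tmvs-layerˡ {X} {T} {h} X-tmvs ⁅h⁆-tmvs T⊆X×h u v =
    subst₂ (Visible P T) (pair-η u) (pair-η v) (visible (fst u) (snd u) (fst v) (snd v))
    where
    visible : ∀ x₁ h₁ x₂ h₂ → Visible P T (pair x₁ h₁) (pair x₂ h₂)
    visible x₁ h₁ x₂ h₂ with X-tmvs x₁ x₂ | ⁅h⁆-tmvs h₁ h₂ | h₂ ≟ h
    ... | p , p-shortest , p-avoids | q , q-shortest , q-avoids | no h₂≢h =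
      layerʳ S x₁ q ++ layerˡ S h₂ p ,
      layerʳ++layerˡ-shortest S p-shortest q-shortest , avoids
      where
      avoids : ∀ w → OnWalk w (layerʳ S x₁ q ++ layerˡ S h₂ p) → w ∈ T → w ≡ pair x₁ h₁ ⊎ w ≡ pair x₂ h₂
      avoids w w∈qp w∈T with onWalk-++⁻ (layerʳ S x₁ q) (layerˡ S h₂ p) w∈qp
      ... | inj₁ w∈q with onWalk-layerˡ⁻ (swap S) x₁ q w∈q
      ... | h′ , h′∈q , refl with proj₂ (T⊆X×h w∈T)
      ... | refl with q-avoids h (h′∈q) (x∈⁅x⁆ h)
      ... | inj₁ refl = inj₁ refl
      ... | inj₂ h≡h₂ = ⊥-elim (h₂≢h (sym h≡h₂))
      avoids w w∈qp w∈T | inj₂ w∈p with onWalk-layerˡ⁻ S h₂ p w∈p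
      ... | _ , _ , refl = ⊥-elim (h₂≢h (proj₂ (T⊆X×h w∈T)))
    ... | p , p-shortest , p-avoids | q , q-shortest , q-avoids | yes refl =
      layerˡ S h₁ p ++ layerʳ S x₂ q ,
      layerˡ++layerʳ-shortest S p-shortest q-shortest , avoids
      where
      avoids : ∀ w → OnWalk w (layerˡ S h₁ p ++ layerʳ S x₂ q) → w ∈ T → w ≡ pair x₁ h₁ ⊎ w ≡ pair x₂ h
      avoids w w∈pq w∈T with onWalk-++⁻ (layerˡ S h₁ p) (layerʳ S x₂ q) w∈pq
      ... | inj₁ w∈p with onWalk-layerˡ⁻ S h₁ p w∈p
      ... | g , g∈p , refl with T⊆X×h w∈T
      ... | g∈X , refl = Sum.map (cong (λ g → pair g h)) (cong (λ g → pair g h)) (p-avoids g g∈p g∈X)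
      avoids w w∈pq w∈T | inj₂ w∈q with onWalk-layerˡ⁻ (swap S) x₂ q w∈q
      ... | _ , _ , refl = inj₂ (cong (pair x₂) (proj₂ (T⊆X×h w∈T)))

  tmvs-≤1ˡ : ∀ {h} → (∀ X → IsTotalMutualVisibilitySet P X → ∣ X ∣ ≤ 1) →
    IsTotalMutualVisibilitySet H ⁅ h ⁆ → ∀ Y → IsTotalMutualVisibilitySet G Y → ∣ Y ∣ ≤ 1
  tmvs-≤1ˡ {h} P≤1 ⁅h⁆-tmvs Y Y-tmvs = subsingleton⇒∣p∣≤1 Y all-equal
    where
    all-equal : ∀ {a b} → a ∈ Y → b ∈ Y → a ≡ b
    all-equal {a} {b} a∈Y b∈Y = decidable-stable (a ≟ b) λ a≢b →
      <⇒≱ (x≢y⇒2≤∣⁅x⁆∪⁅y⁆∣ (a≢b ∘ proj₁ ∘ pair-injective)) (P≤1 T (tmvs-layerˡ Y-tmvs ⁅h⁆-tmvs T⊆Y×h))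
      where
      T = ⁅ pair a h ⁆ ∪ ⁅ pair b h ⁆
      ∈⁅⁆⇒∈Y×h : ∀ {c g h′} → c ∈ Y → pair g h′ ∈ ⁅ pair c h ⁆ → g ∈ Y × h′ ≡ h
      ∈⁅⁆⇒∈Y×h c∈Y gh′∈⁅ch⁆ with pair-injective (x∈⁅y⁆⇒x≡y _ gh′∈⁅ch⁆)
      ... | refl , h′≡h = c∈Y , h′≡h
      T⊆Y×h : ∀ {g h′} → pair g h′ ∈ T → g ∈ Y × h′ ≡ h
      T⊆Y×h gh′∈T = Sum.[ ∈⁅⁆⇒∈Y×h a∈Y , ∈⁅⁆⇒∈Y×h b∈Y ] (x∈p∪q⁻ ⁅ pair a h ⁆ ⁅ pair b h ⁆ gh′∈T)

μt≡1ˡ : ∀ {G H P} → CartesianProduct G H P →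
  TotalMutualVisibilityNumber P 1 → TotalMutualVisibilityNumber G 1
μt≡1ˡ {P = P} S ((X , X-tmvs , ∣X∣≡1) , P≤1) =
  (⁅ fst u ⁆ , tmvs-⁅fst⁆ S u ⁅u⁆-tmvs , ∣⁅x⁆∣≡1 (fst u)) ,
  tmvs-≤1ˡ S P≤1 (tmvs-⁅fst⁆ (swap S) u ⁅u⁆-tmvs)
  where
  open CartesianProduct S
  nonempty : Nonempty X
  nonempty = ∣p∣≢0⇒Nonempty X (λ ∣X∣≡0 → 1+n≢0 (trans (sym ∣X∣≡1) ∣X∣≡0))
  u : Fin (n P)
  u = proj₁ nonempty
  ⁅u⁆-tmvs : IsTotalMutualVisibilitySet P ⁅ u ⁆
  ⁅u⁆-tmvs = tmvs-⊆ (λ v∈⁅u⁆ → subst (_∈ X) (sym (x∈⁅y⁆⇒x≡y u v∈⁅u⁆)) (proj₂ nonempty)) X-tmvs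

proposition4p2 : (G H : Graph) → Connected G → Connected H →
    TotalMutualVisibilityNumber (G □ H) 1 →
    TotalMutualVisibilityNumber G 1 × TotalMutualVisibilityNumber H 1
proposition4p2 G H _ _ μt[G□H]≡1 =
  μt≡1ˡ S μt[G□H]≡1 , μt≡1ˡ (swap S) μt[G□H]≡1
  where S = □-cartesianProduct G H
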